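{- For every single-coalition-first action model $M$ and single-coalition-first neighborhood model $N$, if $M$ is $z$-representable by $N$, then for every $X\in ES$, $M$ is an $X$-model if and only if $N$ is an $X$-model.
   Context: $AG$ is a finite nonempty set of agents, $AP$ a countable set of atomic propositions. For a nonempty set $AC$ and $C\subseteq AG$, $JA_C$ is the set of functions $\sigma_C:C\to AC$ ($JA_\emptyset=\{\emptyset\}$); $\sigma_C|_{\{a\}}$ is the restriction to $\{a\}$; for disjoint $C,D$, $\sigma_C\cup\sigma_D\in JA_{C\cup D}$. A single-coalition-first action model is $M=(ST,AC,suc,\{out_a\}_{a\in AG},L)$ with $ST,AC$ nonempty, $suc:ST\to\mathcal P(ST)$, $out_a:ST\times JA_{\{a\}}\to\mathcal P(ST)$ with $\bigcup\{out_a(s,\sigma_a)\mid\sigma_a\in JA_{\{a\}}\}=suc(s)$ for all $s$, $L:ST\to\mathcal P(AP)$. It determines $out_\emptyset(s,\emptyset)=suc(s)$, $out_C(s,\sigma_C)=\bigcap\{out_a(s,\sigma_C|_{\{a\}})\mid a\in C\}$ for nonempty $C$, $av_C(s)=\{\sigma_C\mid out_C(s,\sigma_C)\neq\emptyset\}$, $AE_C(s)=\{out_C(s,\sigma_C)\mid\sigma_C\in av_C(s)\}$. $M$ is serial if $av_C(s)\neq\emptyset$ for all $C,s$; independent if for all $s$, disjoint $C,D$, $\sigma_C\in av_C(s)$, $\sigma_D\in av_D(s)$: $\sigma_C\cup\sigma_D\in av_{C\cup D}(s)$; deterministic if $out_{AG}(s,\sigma_{AG})$ is a singleton for all $s$ and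 $\sigma_{AG}\in av_{AG}(s)$. A single-coalition-first neighborhood model is $N=(ST,suc,\{nei_a\}_{a\in AG},L)$ with $suc:ST\to\mathcal P(ST)$, $nei_a(s)\subseteq\mathcal P(ST)$ a cover of $suc(s)$ (union $suc(s)$, $\emptyset\notin nei_a(s)$). With $\Delta_1\odot\Delta_2=\{Y_1\cap Y_2\mid Y_i\in\Delta_i,Y_1\cap Y_2\neq\emptyset\}$ (extended to finitely many families, $\bigodot\{\Delta\}=\Delta$): $nei_C(s)=\emptyset$ if $suc(s)=\emptyset$; $\{suc(s)\}$ if $suc(s)\neq\emptyset$, $C=\emptyset$; $\bigodot\{nei_a(s)\mid a\in C\}$ otherwise. $N$ is serial if $nei_C(s)\neq\emptyset$ for all $C,s$; independent if for all $s$, disjoint $C,D$, $Y_1\in nei_C(s)$, $Y_2\in nei_D(s)$: $Y_1\cap Y_2\neq\emptyset$; deterministic if every $Y\in nei_{AG}(s)$ is a singleton. $ES=\{\epsilon,\mathtt S,\mathtt I,\mathtt D,\mathtt{SI},\mathtt{SD},\mathtt{ID},\mathtt{SID}\}$; a model is an $X$-model if it has the properties whose letters ($\mathtt S$ serial, $\mathtt I$ independent, $\mathtt D$ deterministic) occur in $X$. $M$ is $z$-representable by $N$ if they share $ST$ and $L$ and $AE_C=nei_C$ for all $C\subseteq AG$. -}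

module Defs where

open import Level using (Lift; lift; lower) renaming (suc to lsuc; zero to lzero)
open import Data.Nat using (ℕ; suc)
open import Data.Fin using (Fin)
open import Data.Fin.Subset using (Subset; _∈_; _∪_; ⊤; Empty; Nonempty)
open import Data.Fin.Subset.Properties using (x∈p∪q⁻)
open import Data.Product using (Σ; ∃; _×_; _,_)
open import Data.Sum using (_⊎_; [_,_]′)
open import Data.Empty using (⊥)
open import Data.Unit using () renaming (⊤ to ⊤ᵤ)
open import Relation.Binary.PropositionalEquality using (_≡_)
open import Function.Bundles using (_↣_)

Pred : Set → Set₁
Pred A = A → Set

Fam : Set → Set₂
Fam A = Pred A → Set₁

_≐_ : {A : Set} → Pred A → Pred A → Set
X ≐ Y = ∀ x → (X x → Y x) × (Y x → X x)

-- "nonempty" read as "inhabited"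
Inhabited : {A : Set} → Pred A → Set
Inhabited X = ∃ λ x → X x

Singleton : {A : Set} → Pred A → Set
Singleton X = ∃ λ x → ∀ y → (X y → y ≡ x) × (y ≡ x → X y)

_≋_ : {A : Set} → Fam A → Fam A → Set₁
F ≋ G = ∀ Y → (F Y → G Y) × (G Y → F Y)

-- Agents: AG = Fin (suc k) (finite, nonempty).  Coalitions: Subset (suc k).

Disjoint : {n : ℕ} → Subset n → Subset n → Set
Disjoint C D = ∀ a → a ∈ C → a ∈ D → ⊥

JA : {n : ℕ} → Set → Subset n → Set
JA {n} AC C = (a : Fin n) → a ∈ C → AC

_∪ᴶ_ : {n : ℕ} {AC : Set} {C D : Subset n} → JA AC C → JA AC D → JA AC (C ∪ D)
_∪ᴶ_ {C = C} {D} σC σD a p = [ σC a , σD a ]′ (x∈p∪q⁻ C D p)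

-- Single-coalition-first action models.
-- JA_{a} (functions {a} → AC) is identified with AC, so
-- out_a(s, σ_C|_{a}) is written  out a s (σ a p).

record ActionModel (k : ℕ) (AP : Set) (ST : Set) : Set₁ where
  field
    AC     : Set
    st₀    : ST
    ac₀    : AC
    succ   : ST → Pred ST
    out    : Fin (suc k) → ST → AC → Pred ST
    cover  : ∀ a s x → (succ s x → ∃ λ α → out a s α x) × ((∃ λ α → out a s α x) → succ s x)
    L      : ST → Pred AP

  outC : (C : Subset (suc k)) → ST → JA AC C → Pred ST
  outC C s σ x = (Empty C × succ s x) ⊎ (Nonempty C × (∀ a (p : a ∈ C) → out a s (σ a p) x))

  av : (C : Subset (suc k)) → ST → JA AC C → Set
  av C s σ = Inhabited (outC C s σ)

  AE : (C : Subset (suc k)) → ST → Fam ST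
  AE C s Y = Lift (lsuc lzero) (Σ (JA AC C) λ σ → av C s σ × (Y ≐ outC C s σ))

  Serial : Set
  Serial = ∀ C s → Σ (JA AC C) λ σ → av C s σ

  Independent : Set
  Independent = ∀ s C D → Disjoint C D → (σC : JA AC C) (σD : JA AC D) →
                av C s σC → av D s σD → av (C ∪ D) s (σC ∪ᴶ σD)

  Deterministic : Set
  Deterministic = ∀ s (σ : JA AC ⊤) → av ⊤ s σ → Singleton (outC ⊤ s σ)

record NbhdModel (k : ℕ) (AP : Set) (ST : Set) : Set₂ where
  field
    succ   : ST → Pred ST
    nei    : Fin (suc k) → ST → Fam ST
    cover  : ∀ a s x → (succ s x → ∃ λ Y → nei a s Y × Y x) × ((∃ λ Y → nei a s Y × Y x) → succ s x)
    nonemp : ∀ a s Y → nei a s Y → Inhabited Y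
    L      : ST → Pred AP

  -- nei_C(s): empty if suc(s) = ∅; {suc(s)} for C = ∅; ⊙{nei_a(s) | a ∈ C} otherwise.
  neiC : (C : Subset (suc k)) → ST → Fam ST
  neiC C s Y =
    (Empty C × (Y ≐ succ s) × Inhabited Y) ⊎
    (Nonempty C × (Σ ((a : Fin (suc k)) → a ∈ C → Pred ST) λ Ys →
        (∀ a (p : a ∈ C) → nei a s (Ys a p)) ×
        (Y ≐ (λ x → ∀ a (p : a ∈ C) → Ys a p x)) ×
        Inhabited Y))

  Serial : Set₁
  Serial = ∀ C s → ∃ λ Y → neiC C s Y

  Independent : Set₁
  Independent = ∀ s C D → Disjoint C D → ∀ Y₁ Y₂ →
                neiC C s Y₁ → neiC D s Y₂ → Inhabited (λ x → Y₁ x × Y₂ x)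

  Deterministic : Set₁
  Deterministic = ∀ s Y → neiC ⊤ s Y → Singleton Y

data ES : Set where
  ε S I D SI SD ID SID : ES

data Letter : Set where
  lS lI lD : Letter

_occursIn_ : Letter → ES → Set
lS occursIn S   = ⊤ᵤ
lS occursIn SI  = ⊤ᵤ
lS occursIn SD  = ⊤ᵤ
lS occursIn SID = ⊤ᵤ
lI occursIn I   = ⊤ᵤ
lI occursIn SI  = ⊤ᵤ
lI occursIn ID  = ⊤ᵤ
lI occursIn SID = ⊤ᵤ
lD occursIn D   = ⊤ᵤ
lD occursIn SD  = ⊤ᵤ
lD occursIn ID  = ⊤ᵤ
lD occursIn SID = ⊤ᵤ
_  occursIn _   = ⊥

IsXActionModel : {k : ℕ} {AP ST : Set} → ES → ActionModel k AP ST → Set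
IsXActionModel X M = ∀ ℓ → ℓ occursIn X → prop ℓ
  where
    open ActionModel M
    prop : Letter → Set
    prop lS = Serial
    prop lI = Independent
    prop lD = Deterministic

IsXNbhdModel : {k : ℕ} {AP ST : Set} → ES → NbhdModel k AP ST → Set₁
IsXNbhdModel X N = ∀ ℓ → ℓ occursIn X → prop ℓ
  where
    open NbhdModel N
    prop : Letter → Set₁
    prop lS = Serial
    prop lI = Independent
    prop lD = Deterministic

ZRepresentable : {k : ℕ} {AP ST : Set} → ActionModel k AP ST → NbhdModel k AP ST → Set₁
ZRepresentable M N =
  (∀ s → ActionModel.L M s ≐ NbhdModel.L N s) ×
  (∀ C s → ActionModel.AE M C s ≋ NbhdModel.neiC N C s)

{-# OPTIONS --safe #-}
module Submission where

open import Defs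
open import Data.Nat using (ℕ)
open import Data.Product using (_×_)
open import Function.Bundles using (_↣_)

open import Level using (lift)
open import Data.Fin.Subset using (Subset; _∈_; _⊆_; _∪_; ⊤)
open import Data.Fin.Subset.Properties using (x∈p∪q⁻; p⊆p∪q; q⊆p∪q; nonempty?)
open import Data.Vec.Properties.WithK using ([]=-irrelevant)
open import Data.Product using (∃; _,_; proj₁; proj₂; map₂)
open import Data.Sum using (_⊎_; inj₁; inj₂; [_,_]′)
open import Data.Empty using (⊥-elim)
open import Relation.Nullary using (yes; no)
open import Relation.Binary.PropositionalEquality using (_≡_; cong; subst)
open import Function.Bundles using (_⇔_; mk⇔; Equivalence)
open import Function.Construct.Composition using (_⇔-∘_)

-- Each of the three properties of N is, by definition, a property of the
-- assignment C, s ↦ nei_C(s), and the corresponding property of M is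
-- equivalent to the same property of C, s ↦ AE_C(s); z-representability
-- makes the two assignments equal.  The only non-trivial case is
-- independence, where out_{C ∪ D}(s, σ_C ∪ σ_D) = out_C(s, σ_C) ∩ out_D(s, σ_D)
-- for disjoint C and D.

≐-refl : {A : Set} (X : Pred A) → X ≐ X
≐-refl X x = (λ h → h) , (λ h → h)

Singleton-resp-≐ : {A : Set} {X Y : Pred A} → X ≐ Y → Singleton Y → Singleton X
Singleton-resp-≐ X≐Y (y , isY) =
  y , λ x → (λ Xx → proj₁ (isY x) (proj₁ (X≐Y x) Xx)) , (λ x≡y → proj₂ (X≐Y x) (proj₂ (isY x) x≡y))

Effectivity : ℕ → Set → Set₂
Effectivity n ST = Subset n → ST → Fam ST

module _ {n : ℕ} {ST : Set} where

  Serialᴱ : Effectivity n ST → Set₁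
  Serialᴱ F = ∀ C s → ∃ λ Y → F C s Y

  Independentᴱ : Effectivity n ST → Set₁
  Independentᴱ F = ∀ s C₁ C₂ → Disjoint C₁ C₂ → ∀ Y₁ Y₂ →
                   F C₁ s Y₁ → F C₂ s Y₂ → Inhabited (λ x → Y₁ x × Y₂ x)

  Deterministicᴱ : Effectivity n ST → Set₁
  Deterministicᴱ F = ∀ s Y → F ⊤ s Y → Singleton Y

  _≋ᴱ_ : Effectivity n ST → Effectivity n ST → Set₁
  F ≋ᴱ G = ∀ C s → F C s ≋ G C s

  module _ {F G : Effectivity n ST} (F≋G : F ≋ᴱ G) where

    private
      to : ∀ {C s Y} → F C s Y → G C s Y
      to {C} {s} {Y} = proj₁ (F≋G C s Y)

      from : ∀ {C s Y} → G C s Y → F C s Y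
      from {C} {s} {Y} = proj₂ (F≋G C s Y)

    Serialᴱ-cong : Serialᴱ F ⇔ Serialᴱ G
    Serialᴱ-cong = mk⇔ (λ h C s → map₂ to (h C s)) (λ h C s → map₂ from (h C s))

    Independentᴱ-cong : Independentᴱ F ⇔ Independentᴱ G
    Independentᴱ-cong = mk⇔ (λ h s C₁ C₂ C₁#C₂ Y₁ Y₂ GY₁ GY₂ → h s C₁ C₂ C₁#C₂ Y₁ Y₂ (from GY₁) (from GY₂))
                            (λ h s C₁ C₂ C₁#C₂ Y₁ Y₂ FY₁ FY₂ → h s C₁ C₂ C₁#C₂ Y₁ Y₂ (to FY₁) (to FY₂))

    Deterministicᴱ-cong : Deterministicᴱ F ⇔ Deterministicᴱ G
    Deterministicᴱ-cong = mk⇔ (λ h s Y GY → h s Y (from GY)) (λ h s Y FY → h s Y (to FY))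

module _ {n : ℕ} {AC : Set} {C₁ C₂ : Subset n} {σ₁ : JA AC C₁} {σ₂ : JA AC C₂} (C₁#C₂ : Disjoint C₁ C₂) where

  ∪ᴶ-applyˡ : ∀ {a} (p : a ∈ C₁) (q : a ∈ C₁ ∪ C₂) → (σ₁ ∪ᴶ σ₂) a q ≡ σ₁ a p
  ∪ᴶ-applyˡ p q with x∈p∪q⁻ C₁ C₂ q
  ... | inj₁ p′ = cong (σ₁ _) ([]=-irrelevant p′ p)
  ... | inj₂ q′ = ⊥-elim (C₁#C₂ _ p q′)

  ∪ᴶ-applyʳ : ∀ {a} (p : a ∈ C₂) (q : a ∈ C₁ ∪ C₂) → (σ₁ ∪ᴶ σ₂) a q ≡ σ₂ a p
  ∪ᴶ-applyʳ p q with x∈p∪q⁻ C₁ C₂ q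
  ... | inj₁ p′ = ⊥-elim (C₁#C₂ _ p′ p)
  ... | inj₂ q′ = cong (σ₂ _) ([]=-irrelevant q′ p)

module ActionModelProperties {k : ℕ} {AP ST : Set} (M : ActionModel k AP ST) where

  open ActionModel M

  outC⇒succ : ∀ {C s σ x} → outC C s σ x → succ s x
  outC⇒succ (inj₁ (_ , sx)) = sx
  outC⇒succ {s = s} {σ} {x} (inj₂ ((a , p) , o)) = proj₂ (cover a s x) (σ a p , o a p)

  outC⇒out : ∀ {C s σ x a} → outC C s σ x → (p : a ∈ C) → out a s (σ a p) x
  outC⇒out (inj₁ (C-empty , _)) p = ⊥-elim (C-empty (_ , p))
  outC⇒out (inj₂ (_ , o)) p = o _ p

  outC-restrict : ∀ {C E s x} {σ : JA AC C} {τ : JA AC E} (C⊆E : C ⊆ E) →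
                  (∀ {a} (p : a ∈ C) → τ a (C⊆E p) ≡ σ a p) →
                  outC E s τ x → outC C s σ x
  outC-restrict {C} {s = s} {x} C⊆E agree o with nonempty? C
  ... | no C-empty = inj₁ (C-empty , outC⇒succ o)
  ... | yes C-nonempty = inj₂ (C-nonempty , λ a p →
          subst (λ α → out a s α x) (agree p) (outC⇒out o (C⊆E p)))

  outC-∪ᴶ⁻ : ∀ {C₁ C₂ s x} {σ₁ : JA AC C₁} {σ₂ : JA AC C₂} → Disjoint C₁ C₂ →
             outC (C₁ ∪ C₂) s (σ₁ ∪ᴶ σ₂) x → outC C₁ s σ₁ x × outC C₂ s σ₂ x
  outC-∪ᴶ⁻ {C₁} {C₂} {σ₁ = σ₁} {σ₂} C₁#C₂ o =
      outC-restrict (p⊆p∪q C₂) (λ p → ∪ᴶ-applyˡ {σ₁ = σ₁} {σ₂} C₁#C₂ p _) o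
    , outC-restrict (q⊆p∪q C₁ C₂) (λ p → ∪ᴶ-applyʳ {σ₁ = σ₁} {σ₂} C₁#C₂ p _) o

  outC-∪ᴶ⁺ : ∀ {C₁ C₂ s x} {σ₁ : JA AC C₁} {σ₂ : JA AC C₂} →
             outC C₁ s σ₁ x → outC C₂ s σ₂ x → outC (C₁ ∪ C₂) s (σ₁ ∪ᴶ σ₂) x
  outC-∪ᴶ⁺ {C₁} {C₂} {s} {x} {σ₁} {σ₂} o₁ o₂ with nonempty? (C₁ ∪ C₂)
  ... | no C₁∪C₂-empty = inj₁ (C₁∪C₂-empty , outC⇒succ o₁)
  ... | yes C₁∪C₂-nonempty = inj₂ (C₁∪C₂-nonempty , λ a q → out-∪ᴶ (x∈p∪q⁻ C₁ C₂ q))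
    where
    out-∪ᴶ : ∀ {a} (r : a ∈ C₁ ⊎ a ∈ C₂) → out a s ([ σ₁ a , σ₂ a ]′ r) x
    out-∪ᴶ (inj₁ p) = outC⇒out o₁ p
    out-∪ᴶ (inj₂ q) = outC⇒out o₂ q

  AE-outC : ∀ {C s σ} → av C s σ → AE C s (outC C s σ)
  AE-outC {σ = σ} σ-av = lift (σ , σ-av , ≐-refl _)

  Serial⇔Serialᴱ : Serial ⇔ Serialᴱ AE
  Serial⇔Serialᴱ = mk⇔ to from
    where
    to : Serial → Serialᴱ AE
    to h C s with h C s
    ... | σ , σ-av = outC C s σ , AE-outC σ-av

    from : Serialᴱ AE → Serial
    from h C s with h C s
    ... | _ , lift (σ , σ-av , _) = σ , σ-av

  Independent⇔Independentᴱ : Independent ⇔ Independentᴱ AE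
  Independent⇔Independentᴱ = mk⇔ to from
    where
    to : Independent → Independentᴱ AE
    to h s C₁ C₂ C₁#C₂ Y₁ Y₂ (lift (σ₁ , σ₁-av , Y₁≐)) (lift (σ₂ , σ₂-av , Y₂≐)) =
      let x , o = h s C₁ C₂ C₁#C₂ σ₁ σ₂ σ₁-av σ₂-av
          o₁ , o₂ = outC-∪ᴶ⁻ C₁#C₂ o
      in x , proj₂ (Y₁≐ x) o₁ , proj₂ (Y₂≐ x) o₂

    from : Independentᴱ AE → Independent
    from h s C₁ C₂ C₁#C₂ σ₁ σ₂ σ₁-av σ₂-av =
      let x , o₁ , o₂ = h s C₁ C₂ C₁#C₂ _ _ (AE-outC σ₁-av) (AE-outC σ₂-av)
      in x , outC-∪ᴶ⁺ o₁ o₂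

  Deterministic⇔Deterministicᴱ : Deterministic ⇔ Deterministicᴱ AE
  Deterministic⇔Deterministicᴱ = mk⇔ to from
    where
    to : Deterministic → Deterministicᴱ AE
    to h s Y (lift (σ , σ-av , Y≐)) = Singleton-resp-≐ Y≐ (h s σ σ-av)

    from : Deterministicᴱ AE → Deterministic
    from h s σ σ-av = h s _ (AE-outC σ-av)

theorem4p13 : (k : ℕ) (AP : Set) → (AP ↣ ℕ) → (ST : Set)
    (M : ActionModel k AP ST) (N : NbhdModel k AP ST) →
    ZRepresentable M N →
    (X : ES) → (IsXActionModel X M → IsXNbhdModel X N) × (IsXNbhdModel X N → IsXActionModel X M)
theorem4p13 k AP _ ST M N (_ , AE≋nei) X = fwd , bwd
  where
  open ActionModelProperties M
  open Equivalence

  serial : ActionModel.Serial M ⇔ NbhdModel.Serial N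
  serial = Serialᴱ-cong AE≋nei ⇔-∘ Serial⇔Serialᴱ

  independent : ActionModel.Independent M ⇔ NbhdModel.Independent N
  independent = Independentᴱ-cong AE≋nei ⇔-∘ Independent⇔Independentᴱ

  deterministic : ActionModel.Deterministic M ⇔ NbhdModel.Deterministic N
  deterministic = Deterministicᴱ-cong AE≋nei ⇔-∘ Deterministic⇔Deterministicᴱ

  fwd : IsXActionModel X M → IsXNbhdModel X N
  fwd h lS o = to serial (h lS o)
  fwd h lI o = to independent (h lI o)
  fwd h lD o = to deterministic (h lD o)

  bwd : IsXNbhdModel X N → IsXActionModel X M
  bwd h lS o = from serial (h lS o)
  bwd h lI o = from independent (h lI o)
  bwd h lD o = from deterministic (h lD o)
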